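{- If $V$ is a value and $\Gamma \,\|\, \Theta \vdash V : A_{\square} ; \Delta$ (i.e. $V$ has a modal type $A$, $\varpi(A)=\square$), then $\Gamma_{\square} \,\|\, \Theta \vdash V : A_{\square} ; \diamond$, where $\Gamma_{\square}$ is a context containing only variables whose types have polarity $\square$ and no covariables are used.
   Context: System $\mathbf{L}^{\Box}_{\mathrm{pol}}$: a polarised sequent calculus (L-calculus) for classical S4 with three polarities $+$ (positive, call-by-value), $-$ (negative, call-by-name) and $\square$ (modal positive, call-by-value). Types: $A,B ::= \mathbb{1} \mid A\otimes B \mid A\oplus B \mid \Box A \mid \neg A \mid A \mathbin{\&} B \mid A ⅋ B$, where ⅋ ("par") is the negative disjunction. Polarities: $\varpi(\mathbb{1})=\varpi(\Box A)=\square$; $\varpi(\neg A)=\varpi(A\mathbin{\&}B)=\varpi(A ⅋ B)=-$; $\varpi(A\otimes B)=\varpi(A\oplus B)=\square$ if $\varpi(A)=\varpi(B)=\square$, and $+$ otherwise. $A_\epsilon$ asserts $\varpi(A)=\epsilon$. Values: $V ::= x \mid (V,W) \mid \square V \mid () \mid \iota_i V \mid \mu[x^\epsilon].c \mid \mu(\pi_1\alpha^{\epsilon_1}.c_1 \mid \pi_2\beta^{\epsilon_2}.c_2) \mid \mu(\alpha^{\epsilon_1},\beta^{\epsilon_2}).c \mid \mu\alpha^-.c$. Co-values: $S ::= \alpha \mid \pi_i S \mid \tilde\mu\square x^\epsilon.c \mid [V] \mid (S,S') \mid \tilde\mu().c \mid \tilde\mu x^{+/\square}.c \mid \tilde\mu(x^{\epsilon_1},y^{\epsilon_2}).c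 \mid \tilde\mu[\iota_1 x^{\epsilon_1}.c_1 \mid \iota_2 y^{\epsilon_2}.c_2]$. Commands are $\langle t \mid e\rangle^{\epsilon}$. Typing contexts $(\Gamma \,\|\, \Theta \vdash \Delta)$: $\Gamma$ ordinary variables, $\Theta$ modal variables ($x:A\in\Theta$ read as $x:\Box A$), $\Delta$ covariables; all admit weakening, contraction, exchange (via renamings). Judgment $\Gamma \,\|\, \Theta \vdash V : A ; \Delta$ means $V$ is a value of type $A$ in that context. Key rule: $\square V : \Box A$ is derivable only from $\Gamma_{\square} \,\|\, \Theta \vdash V : A ; \diamond$ (ordinary context modal-only, empty covariable context); eliminating $\Box A$ via $\tilde\mu\square x.c$ puts $x:A$ into $\Theta$. -}

module Defs where

open import Data.Nat using (ℕ)
open import Data.Product using (_×_; _,_)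
open import Data.List using (List; []; _∷_)
open import Data.List.Membership.Propositional using (_∈_)
open import Relation.Binary.PropositionalEquality using (_≡_)

data Pol : Set where
  pos neg box : Pol

data Ty : Set where
  𝟙       : Ty
  _⊗_     : Ty → Ty → Ty
  _⊕_     : Ty → Ty → Ty
  □_      : Ty → Ty
  ¬_      : Ty → Ty
  _&_     : Ty → Ty → Ty
  _⅋_     : Ty → Ty → Ty

joinPos : Pol → Pol → Pol
joinPos box box = box
joinPos _   _   = pos

ϖ : Ty → Pol
ϖ 𝟙       = box
ϖ (A ⊗ B) = joinPos (ϖ A) (ϖ B)
ϖ (A ⊕ B) = joinPos (ϖ A) (ϖ B)
ϖ (□ A)   = box
ϖ (¬ A)   = neg
ϖ (A & B) = neg
ϖ (A ⅋ B) = neg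

-- Raw syntax (names are natural numbers; variables and covariables
-- live in separate contexts)

Var : Set
Var = ℕ

data Idx : Set where
  i₁ i₂ : Idx

mutual
  data Command : Set where
    ⟨_∣_⟩^_ : Term → Context → Pol → Command

  data Term : Set where
    val : Value → Term
    μ_^_∙_ : Var → Pol → Command → Term

  data Context : Set where
    coval : CoValue → Context
    μ̃⁻_∙_ : Var → Command → Context

  data Value : Set where
    var      : Var → Value
    pair     : Value → Value → Value
    box      : Value → Value
    unit     : Value
    inj      : Idx → Value → Value
    μneg     : Var → Pol → Command → Value
    μwith    : Var → Pol → Command → Var → Pol → Command → Value
    μpar     : Var → Pol → Var → Pol → Command → Value
    μ⁻       : Var → Command → Value

  data CoValue : Set where
    covar    : Var → CoValue
    proj     : Idx → CoValue → CoValue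
    μ̃box     : Var → Pol → Command → CoValue
    brack    : Value → CoValue
    copair   : CoValue → CoValue → CoValue
    μ̃unit    : Command → CoValue
    μ̃        : Var → Pol → Command → CoValue
    μ̃pair    : Var → Pol → Var → Pol → Command → CoValue
    μ̃case    : Var → Pol → Command → Var → Pol → Command → CoValue

Ctx : Set
Ctx = List (Var × Ty)

_□ : Ctx → Ctx
[] □ = []
((x , A) ∷ Γ) □ with ϖ A
... | box = (x , A) ∷ (Γ □)
... | pos = Γ □
... | neg = Γ □

data PosOrBox : Pol → Set where
  isPos : PosOrBox pos
  isBox : PosOrBox box

sel : Idx → Ty → Ty → Ty
sel i₁ A B = A
sel i₂ A B = B

-- Typing judgments  (Γ ‖ Θ ⊢ … ; Δ).
-- Θ holds modal variables: x : A ∈ Θ is read as x : □A.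

infix 3 _‖_⊢ᶜ_∶_ _‖_⊢ᵗ_∶_⍮_ _‖_∣ᵉ_∶_⊢_ _‖_⊢_∶_⍮_ _‖_∣_∶_⊢_

mutual
  data _‖_⊢ᶜ_∶_ (Γ Θ : Ctx) : Command → Ctx → Set where
    cut : ∀ {t e A Δ} →
          Γ ‖ Θ ⊢ᵗ t ∶ A ⍮ Δ → Γ ‖ Θ ∣ᵉ e ∶ A ⊢ Δ →
          Γ ‖ Θ ⊢ᶜ ⟨ t ∣ e ⟩^ ϖ A ∶ Δ

  data _‖_⊢ᵗ_∶_⍮_ (Γ Θ : Ctx) : Term → Ty → Ctx → Set where
    tval : ∀ {V A Δ} → Γ ‖ Θ ⊢ V ∶ A ⍮ Δ → Γ ‖ Θ ⊢ᵗ val V ∶ A ⍮ Δ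
    tμ   : ∀ {α c A Δ} → PosOrBox (ϖ A) →
           Γ ‖ Θ ⊢ᶜ c ∶ ((α , A) ∷ Δ) →
           Γ ‖ Θ ⊢ᵗ μ α ^ ϖ A ∙ c ∶ A ⍮ Δ

  data _‖_∣ᵉ_∶_⊢_ (Γ Θ : Ctx) : Context → Ty → Ctx → Set where
    ecov : ∀ {S A Δ} → Γ ‖ Θ ∣ S ∶ A ⊢ Δ → Γ ‖ Θ ∣ᵉ coval S ∶ A ⊢ Δ
    eμ̃⁻  : ∀ {x c A Δ} → ϖ A ≡ neg →
           ((x , A) ∷ Γ) ‖ Θ ⊢ᶜ c ∶ Δ →
           Γ ‖ Θ ∣ᵉ μ̃⁻ x ∙ c ∶ A ⊢ Δ

  data _‖_⊢_∶_⍮_ (Γ Θ : Ctx) : Value → Ty → Ctx → Set where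
    vvar   : ∀ {x A Δ} → (x , A) ∈ Γ → Γ ‖ Θ ⊢ var x ∶ A ⍮ Δ
    vmvar  : ∀ {x A Δ} → (x , A) ∈ Θ → Γ ‖ Θ ⊢ var x ∶ A ⍮ Δ
    vpair  : ∀ {V W A B Δ} → Γ ‖ Θ ⊢ V ∶ A ⍮ Δ → Γ ‖ Θ ⊢ W ∶ B ⍮ Δ →
             Γ ‖ Θ ⊢ pair V W ∶ A ⊗ B ⍮ Δ
    vbox   : ∀ {V A Δ} → (Γ □) ‖ Θ ⊢ V ∶ A ⍮ [] →
             Γ ‖ Θ ⊢ box V ∶ □ A ⍮ Δ
    vunit  : ∀ {Δ} → Γ ‖ Θ ⊢ unit ∶ 𝟙 ⍮ Δ
    vinj   : ∀ {i V A B Δ} → Γ ‖ Θ ⊢ V ∶ sel i A B ⍮ Δ →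
             Γ ‖ Θ ⊢ inj i V ∶ A ⊕ B ⍮ Δ
    vμneg  : ∀ {x c A Δ} → ((x , A) ∷ Γ) ‖ Θ ⊢ᶜ c ∶ Δ →
             Γ ‖ Θ ⊢ μneg x (ϖ A) c ∶ ¬ A ⍮ Δ
    vμwith : ∀ {α β c₁ c₂ A B Δ} →
             Γ ‖ Θ ⊢ᶜ c₁ ∶ ((α , A) ∷ Δ) → Γ ‖ Θ ⊢ᶜ c₂ ∶ ((β , B) ∷ Δ) →
             Γ ‖ Θ ⊢ μwith α (ϖ A) c₁ β (ϖ B) c₂ ∶ A & B ⍮ Δ
    vμpar  : ∀ {α β c A B Δ} →
             Γ ‖ Θ ⊢ᶜ c ∶ ((α , A) ∷ (β , B) ∷ Δ) →
             Γ ‖ Θ ⊢ μpar α (ϖ A) β (ϖ B) c ∶ A ⅋ B ⍮ Δ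
    vμ⁻    : ∀ {α c A Δ} → ϖ A ≡ neg →
             Γ ‖ Θ ⊢ᶜ c ∶ ((α , A) ∷ Δ) →
             Γ ‖ Θ ⊢ μ⁻ α c ∶ A ⍮ Δ

  data _‖_∣_∶_⊢_ (Γ Θ : Ctx) : CoValue → Ty → Ctx → Set where
    scovar : ∀ {α A Δ} → (α , A) ∈ Δ → Γ ‖ Θ ∣ covar α ∶ A ⊢ Δ
    sproj  : ∀ {i S A B Δ} → Γ ‖ Θ ∣ S ∶ sel i A B ⊢ Δ →
             Γ ‖ Θ ∣ proj i S ∶ A & B ⊢ Δ
    sμ̃box  : ∀ {x c A Δ} → Γ ‖ ((x , A) ∷ Θ) ⊢ᶜ c ∶ Δ →
             Γ ‖ Θ ∣ μ̃box x (ϖ A) c ∶ □ A ⊢ Δ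
    sbrack : ∀ {V A Δ} → Γ ‖ Θ ⊢ V ∶ A ⍮ Δ →
             Γ ‖ Θ ∣ brack V ∶ ¬ A ⊢ Δ
    scopair : ∀ {S S′ A B Δ} → Γ ‖ Θ ∣ S ∶ A ⊢ Δ → Γ ‖ Θ ∣ S′ ∶ B ⊢ Δ →
             Γ ‖ Θ ∣ copair S S′ ∶ A ⅋ B ⊢ Δ
    sμ̃unit : ∀ {c Δ} → Γ ‖ Θ ⊢ᶜ c ∶ Δ → Γ ‖ Θ ∣ μ̃unit c ∶ 𝟙 ⊢ Δ
    sμ̃     : ∀ {x c A Δ} → PosOrBox (ϖ A) →
             ((x , A) ∷ Γ) ‖ Θ ⊢ᶜ c ∶ Δ →
             Γ ‖ Θ ∣ μ̃ x (ϖ A) c ∶ A ⊢ Δ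
    sμ̃pair : ∀ {x y c A B Δ} → ((x , A) ∷ (y , B) ∷ Γ) ‖ Θ ⊢ᶜ c ∶ Δ →
             Γ ‖ Θ ∣ μ̃pair x (ϖ A) y (ϖ B) c ∶ A ⊗ B ⊢ Δ
    sμ̃case : ∀ {x y c₁ c₂ A B Δ} →
             ((x , A) ∷ Γ) ‖ Θ ⊢ᶜ c₁ ∶ Δ → ((y , B) ∷ Γ) ‖ Θ ⊢ᶜ c₂ ∶ Δ →
             Γ ‖ Θ ∣ μ̃case x (ϖ A) c₁ y (ϖ B) c₂ ∶ A ⊕ B ⊢ Δ

-- A value of modal type is built from variables, units, pairs, injections
-- and boxes only: every other value former has a negative type. Induction
-- on the derivation therefore never meets a covariable, and every ordinary
-- variable it meets has a modal type, so it survives in Γ □. A box is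
-- already typed in (Γ □) and filtering a context twice changes nothing.
module Submission where

open import Defs
open import Data.List using ([]; _∷_)
open import Data.Product using (_×_; _,_; proj₁; proj₂)
open import Data.List.Membership.Propositional using (_∈_)
open import Data.List.Relation.Unary.Any using (here; there)
open import Relation.Binary.PropositionalEquality using (_≡_; refl; sym; trans; subst)

joinPos-box⁻ : ∀ p q → joinPos p q ≡ box → p ≡ box × q ≡ box
joinPos-box⁻ box box refl = refl , refl
joinPos-box⁻ box pos ()
joinPos-box⁻ box neg ()
joinPos-box⁻ pos q ()
joinPos-box⁻ neg q ()

ϖ-sel-box : ∀ i A B → ϖ (A ⊕ B) ≡ box → ϖ (sel i A B) ≡ box
ϖ-sel-box i₁ A B e = proj₁ (joinPos-box⁻ (ϖ A) (ϖ B) e)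
ϖ-sel-box i₂ A B e = proj₂ (joinPos-box⁻ (ϖ A) (ϖ B) e)

∈-□⁺ : ∀ {Γ x A} → ϖ A ≡ box → (x , A) ∈ Γ → (x , A) ∈ (Γ □)
∈-□⁺ {(y , B) ∷ Γ} e (here refl) with ϖ B
∈-□⁺ {(y , B) ∷ Γ} refl (here refl) | .box = here refl
∈-□⁺ {(y , B) ∷ Γ} e (there x∈Γ) with ϖ B
... | box = there (∈-□⁺ e x∈Γ)
... | pos = ∈-□⁺ e x∈Γ
... | neg = ∈-□⁺ e x∈Γ

□-idempotent : ∀ Γ → (Γ □) □ ≡ Γ □
□-idempotent [] = refl
□-idempotent ((x , A) ∷ Γ) with ϖ A in eq
... | box rewrite eq | □-idempotent Γ = refl
... | pos = □-idempotent Γ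
... | neg = □-idempotent Γ

mainTheorem1 : ∀ {Γ Θ Δ V A} → ϖ A ≡ box → Γ ‖ Θ ⊢ V ∶ A ⍮ Δ →
    (Γ □) ‖ Θ ⊢ V ∶ A ⍮ []
mainTheorem1 e (vvar x∈Γ) = vvar (∈-□⁺ e x∈Γ)
mainTheorem1 e (vmvar x∈Θ) = vmvar x∈Θ
mainTheorem1 {A = A ⊗ B} e (vpair v w) =
  let (eA , eB) = joinPos-box⁻ (ϖ A) (ϖ B) e
  in vpair (mainTheorem1 eA v) (mainTheorem1 eB w)
mainTheorem1 {Γ} {Θ} e (vbox {V} {A} v) =
  vbox (subst (λ Γ′ → Γ′ ‖ Θ ⊢ V ∶ A ⍮ []) (sym (□-idempotent Γ)) v)
mainTheorem1 e vunit = vunit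
mainTheorem1 {A = A ⊕ B} e (vinj {i} v) = vinj (mainTheorem1 (ϖ-sel-box i A B e) v)
mainTheorem1 () (vμneg c)
mainTheorem1 () (vμwith c₁ c₂)
mainTheorem1 () (vμpar c)
mainTheorem1 e (vμ⁻ ϖA≡neg c) with trans (sym ϖA≡neg) e
... | ()
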